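{- Let $n\in\mathbb{N}$. The set of edges $\Gamma_0(n)\cdot I$ is a subset of the set of edges common to $\mathcal{F}$ and $\frac{1}{n}\mathcal{F}$, and these two sets are equal if and only if $n$ is a prime power.
   Context: Work in the upper half-plane with $\infty=\frac{1}{0}$. The Farey tessellation $\mathcal{F}$ is the ideal triangulation with vertex set $\mathbb{Q}\cup\{\infty\}$ in which reduced $\frac{p}{q},\frac{r}{s}$ are joined by a geodesic edge iff $|ps-qr|=1$; $\frac{1}{n}\mathcal{F}$ is the image of $\mathcal{F}$ under $z\mapsto z/n$. $\Gamma_0(n)=\{\begin{psmallmatrix}a&b\\c&d\end{psmallmatrix}\in PSL_2(\mathbb{Z}): c\equiv0 \pmod n\}$ acting by Möbius transformations, $I$ is the geodesic from $0$ to $\infty$, and $\Gamma_0(n)\cdot I=\{\phi\cdot I:\phi\in\Gamma_0(n)\}$. "Prime power" means $n=p^\ell$ with $p$ prime and $\ell\ge0$. -}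

module Defs where

open import Data.Nat as ℕ using (ℕ; _^_)
open import Data.Nat.Coprimality using (Coprime)
open import Data.Nat.Primality using (Prime)
open import Data.Integer as ℤ using (ℤ; +_; ∣_∣; _*_; _-_)
open import Data.Integer.Divisibility using (_∣_)
open import Data.Product using (Σ; ∃; _×_; _,_)
open import Data.Sum using (_⊎_)
open import Relation.Binary.PropositionalEquality using (_≡_)

-- A point of ℚ ∪ {∞} = P¹(ℚ) is represented by a reduced (primitive)
-- integer pair (p , q), standing for p/q; ∞ = 1/0 is (±1 , 0).
-- Coprime ∣p∣ ∣q∣ excludes (0 , 0) since gcd 0 0 = 0.
record Point : Set where
  constructor pt
  field
    num : ℤ
    den : ℤ
    reduced : Coprime ∣ num ∣ ∣ den ∣
open Point public

-- The point represented by a point x equals the point (a : c) of P¹(ℚ)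
-- (for (a , c) a nonzero integer vector): projective equality.
_≈_ : Point → ℤ × ℤ → Set
x ≈ (a , c) = num x * c ≡ a * den x

-- Edge of the Farey tessellation F between reduced p/q and r/s: |ps - qr| = 1.
FEdge : Point → Point → Set
FEdge x y = ∣ num x * den y - den x * num y ∣ ≡ 1

-- Image of a point p/q under z ↦ z/n, as a (not necessarily reduced) vector.
scale : ℕ → Point → ℤ × ℤ
scale n z = (num z , + n * den z)

-- Edge of (1/n)F: the image under z ↦ z/n of an edge {z , w} of F.
FnEdge : ℕ → Point → Point → Set
FnEdge n x y = Σ Point λ z → Σ Point λ w →
  FEdge z w × x ≈ scale n z × y ≈ scale n w

-- Edge of Γ₀(n)·I: the geodesic from φ·∞ = a/c to φ·0 = b/d for
-- φ = [[a , b] , [c , d]] with ad - bc = 1 and n ∣ c (unordered endpoints).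
Γ₀Edge : ℕ → Point → Point → Set
Γ₀Edge n x y = Σ ℤ λ a → Σ ℤ λ b → Σ ℤ λ c → Σ ℤ λ d →
  (a * d - b * c ≡ ℤ.1ℤ) × (+ n ∣ c) ×
  ((x ≈ (a , c) × y ≈ (b , d)) ⊎ (x ≈ (b , d) × y ≈ (a , c)))

CommonEdge : ℕ → Point → Point → Set
CommonEdge n x y = FEdge x y × FnEdge n x y

IsPrimePower : ℕ → Set
IsPrimePower n = Σ ℕ λ p → Σ ℕ λ ℓ → Prime p × n ≡ p ^ ℓ

-- Write ⟦ x , y ⟧ = ps − qr for reduced x = p/q and y = r/s, so that the edges of F are the pairs
-- with ⟦ x , y ⟧ = ±1.  For φ = [[a , b] , [c , d]] ∈ Γ₀(n) the edge φ·I joins the columns a/c and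
-- b/d of φ; it lies in F, and it is the image under z ↦ z/n of the edge of F joining the columns of
-- [[a , nb] , [c/n , d]].  Conversely an edge x , y of F is of the form φ·I, with φ = [[p , Dr] , [q , Ds]]
-- where D = ⟦ x , y ⟧, as soon as n divides one of its denominators.
-- If x , y is moreover the image of the edge z , w of F, then (num z , n den z) = λ x and
-- (num w , n den w) = μ y, and comparing ⟦ z , w ⟧ with ⟦ x , y ⟧ gives n = |λ| |μ| with λ, μ coprime
-- (they divide num z and num w).  For a prime power n one of λ, μ is a unit, so n divides q or s.
-- If n = mk with coprime m, k > 1, then mα − kβ = 1 makes (α/kβ , 1/m) a common edge of F and
-- (1/n)F (the image of (mα/β , k/1)) whose denominators are not divisible by n.
module Submission where

open import Defs
open import Data.Nat using (ℕ; _≤_)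
open import Data.Product using (_×_)
open import Function.Bundles using (_⇔_; mk⇔)

open import Data.Integer using (ℤ; +_; -[1+_]; ∣_∣; _*_; _-_; _+_; -_; 1ℤ)
open import Data.Integer.Coprimality using (Coprime)
open import Data.Integer.Divisibility using (_∣_)
import Data.Integer.Divisibility.Signed as Signed
import Data.Integer.Properties as ℤₚ
open import Data.Integer.Tactic.RingSolver using (solve-∀)
open import Data.List using ([]; _∷_)
open import Data.List.Relation.Unary.All using (_∷_)
import Data.Nat as ℕ
open import Data.Nat using (2+)
import Data.Nat.Coprimality as ℕ
import Data.Nat.Divisibility as ℕ
open import Data.Nat.GCD using (module Bézout)
open import Data.Nat.Induction using (<-wellFounded)
open import Data.Nat.ListAction using (product)
open import Data.Nat.Primality using (Prime; prime[2]; euclidsLemma; prime⇒nonZero; prime⇒nonTrivial)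
open import Data.Nat.Primality.Factorisation using (factorise)
import Data.Nat.Properties as ℕₚ
import Data.Nat.Tactic.RingSolver as ℕ-RingSolver
open import Data.Product using (Σ; _,_)
open import Data.Sum as Sum using (_⊎_; inj₁; inj₂)
open import Induction.WellFounded using (Acc; acc)
open import Relation.Binary.PropositionalEquality
open import Relation.Nullary using (¬_; contradiction; yes; no)

det : ℤ → ℤ → ℤ → ℤ → ℤ
det a b c d = a * d - b * c

⟦_,_⟧ : Point → Point → ℤ
⟦ x , y ⟧ = num x * den y - den x * num y

∣i∣≡1⇒i*i≡1 : ∀ i → ∣ i ∣ ≡ 1 → i * i ≡ 1ℤ
∣i∣≡1⇒i*i≡1 (+ 1)                _ = refl
∣i∣≡1⇒i*i≡1 -[1+ 0 ]             _ = refl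
∣i∣≡1⇒i*i≡1 (+ 0)                ()
∣i∣≡1⇒i*i≡1 (+ ℕ.suc (ℕ.suc _))  ()
∣i∣≡1⇒i*i≡1 -[1+ ℕ.suc _ ]       ()

∣i∣≡1∧∣j∣≡1⇒∣i*j∣≡1 : ∀ i j → ∣ i ∣ ≡ 1 → ∣ j ∣ ≡ 1 → ∣ i * j ∣ ≡ 1
∣i∣≡1∧∣j∣≡1⇒∣i*j∣≡1 i j ∣i∣≡1 ∣j∣≡1 = trans (ℤₚ.abs-* i j) (cong₂ ℕ._*_ ∣i∣≡1 ∣j∣≡1)

∣i∣≡1∧k∣i*j⇒k∣j : ∀ {k} i {j} → ∣ i ∣ ≡ 1 → k ∣ i * j → k ∣ j
∣i∣≡1∧k∣i*j⇒k∣j i {j} ∣i∣≡1 k∣ij =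
  subst (_ ℕ.∣_) (trans (ℤₚ.abs-* i j) (trans (cong (ℕ._* ∣ j ∣) ∣i∣≡1) (ℕₚ.*-identityˡ ∣ j ∣))) k∣ij

i∣i*j : ∀ i j → i ∣ i * j
i∣i*j i j = Signed.∣⇒∣ᵤ {i} (Signed.∣m⇒∣m*n {i} j Signed.∣-refl)

∣j⇒∣i*j : ∀ {k} i {j} → k ∣ j → k ∣ i * j
∣j⇒∣i*j {k} i {j} k∣j = Signed.∣⇒∣ᵤ {k} (Signed.∣n⇒∣m*n i (Signed.∣ᵤ⇒∣ {k} {j} k∣j))

bézout⇒coprime : ∀ a b {u v} → a * u + b * v ≡ 1ℤ → Coprime a b
bézout⇒coprime a b {u} {v} au+bv≡1 {k} (k∣a , k∣b) =
  ℕ.∣1⇒≡1 (Signed.∣⇒∣ᵤ {+ k} (subst (+ k Signed.∣_) au+bv≡1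
    (Signed.∣m∣n⇒∣m+n (Signed.∣m⇒∣m*n u (Signed.∣ᵤ⇒∣ {+ k} {a} k∣a))
                      (Signed.∣m⇒∣m*n v (Signed.∣ᵤ⇒∣ {+ k} {b} k∣b)))))

coprime∧∣⇒coprime : ∀ {i j k l} → ℕ.Coprime i j → k ℕ.∣ i → l ℕ.∣ j → ℕ.Coprime k l
coprime∧∣⇒coprime coprime k∣i l∣j (d∣k , d∣l) = coprime (ℕ.∣-trans d∣k k∣i , ℕ.∣-trans d∣l l∣j)

record SL₂ℤ : Set where
  constructor mat
  field
    a b c d : ℤ
    det≡1 : det a b c d ≡ 1ℤ

swapColumns : SL₂ℤ → SL₂ℤ
swapColumns (mat a b c d det≡1) = mat b (- a) d (- c) (trans (e a b c d) det≡1)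
  where
  e : ∀ a b c d → b * (- c) - (- a) * d ≡ a * d - b * c
  e = solve-∀

column₁ : SL₂ℤ → Point
column₁ (mat a b c d det≡1) = pt a c (bézout⇒coprime a c (trans (e a b c d) det≡1))
  where
  e : ∀ a b c d → a * d + c * (- b) ≡ a * d - b * c
  e = solve-∀

column₂ : SL₂ℤ → Point
column₂ (mat a b c d det≡1) = pt b d (bézout⇒coprime b d (trans (e a b c d) det≡1))
  where
  e : ∀ a b c d → b * (- c) + d * a ≡ a * d - b * c
  e = solve-∀

columns-FEdge : ∀ M → FEdge (column₁ M) (column₂ M)
columns-FEdge (mat a b c d det≡1) = cong ∣_∣ (trans (e a b c d) det≡1)
  where
  e : ∀ a b c d → a * d - c * b ≡ a * d - b * c
  e = solve-∀

-- Existence lemmas that are later scrutinised by `with` are kept opaque: unfolding their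
-- ring-solver proofs there exhausts memory.
opaque
  -- Cramer's rule: the multiplier is det u b v d.
  parallel⇒multiple : ∀ {u v} M → let open SL₂ℤ M in u * c ≡ a * v → Σ ℤ λ l → u ≡ l * a × v ≡ l * c
  parallel⇒multiple {u} {v} (mat a b c d det≡1) uc≡av = det u b v d , sym first , sym second
    where
    open ≡-Reasoning
    e₁ : ∀ u v a b d → (u * d - b * v) * a ≡ u * a * d - b * (a * v)
    e₁ = solve-∀
    e₂ : ∀ u a b c d → u * a * d - b * (u * c) ≡ u * (a * d - b * c)
    e₂ = solve-∀
    e₃ : ∀ u v b c d → (u * d - b * v) * c ≡ d * (u * c) - v * b * c
    e₃ = solve-∀
    e₄ : ∀ v a b c d → d * (a * v) - v * b * c ≡ v * (a * d - b * c)
    e₄ = solve-∀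
    first : det u b v d * a ≡ u
    first = begin
      det u b v d * a            ≡⟨ e₁ u v a b d ⟩
      u * a * d - b * (a * v)    ≡⟨ cong (λ t → u * a * d - b * t) uc≡av ⟨
      u * a * d - b * (u * c)    ≡⟨ e₂ u a b c d ⟩
      u * det a b c d            ≡⟨ cong (u *_) det≡1 ⟩
      u * 1ℤ                     ≡⟨ ℤₚ.*-identityʳ u ⟩
      u                          ∎
    second : det u b v d * c ≡ v
    second = begin
      det u b v d * c            ≡⟨ e₃ u v b c d ⟩
      d * (u * c) - v * b * c    ≡⟨ cong (λ t → d * t - v * b * c) uc≡av ⟩
      d * (a * v) - v * b * c    ≡⟨ e₄ v a b c d ⟩
      v * det a b c d            ≡⟨ cong (v *_) det≡1 ⟩
      v * 1ℤ                     ≡⟨ ℤₚ.*-identityʳ v ⟩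
      v                          ∎

opaque
  ≈column₁⇒unitMultiple : ∀ M (x : Point) → let open SL₂ℤ M in x ≈ (a , c) →
                          Σ ℤ λ l → ∣ l ∣ ≡ 1 × num x ≡ l * a × den x ≡ l * c
  ≈column₁⇒unitMultiple M@(mat a b c d _) x x≈ with parallel⇒multiple M x≈
  ... | l , P≡la , Q≡lc =
    l , reduced x (subst (l ∣_) (sym P≡la) (i∣i*j l a) , subst (l ∣_) (sym Q≡lc) (i∣i*j l c)) , P≡la , Q≡lc

FEdge-sym : ∀ x y → FEdge x y → FEdge y x
FEdge-sym x y f = trans (cong ∣_∣ (e (num x) (den x) (num y) (den y))) (trans (ℤₚ.∣-i∣≡∣i∣ ⟦ x , y ⟧) f)
  where
  e : ∀ P Q R S → R * Q - S * P ≡ - (P * S - Q * R)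
  e = solve-∀

CommonEdge-sym : ∀ n x y → CommonEdge n x y → CommonEdge n y x
CommonEdge-sym n x y (fxy , z , w , fzw , x≈z , y≈w) = FEdge-sym x y fxy , w , z , FEdge-sym z w fzw , y≈w , x≈z

Γ₀Edge-sym : ∀ n x y → Γ₀Edge n x y → Γ₀Edge n y x
Γ₀Edge-sym n x y (a , b , c , d , det≡1 , n∣c , inj₁ (x≈ , y≈)) = a , b , c , d , det≡1 , n∣c , inj₂ (y≈ , x≈)
Γ₀Edge-sym n x y (a , b , c , d , det≡1 , n∣c , inj₂ (x≈ , y≈)) = a , b , c , d , det≡1 , n∣c , inj₁ (y≈ , x≈)

columns⇒FEdge : ∀ M x y → let open SL₂ℤ M in x ≈ (a , c) → y ≈ (b , d) → FEdge x y
columns⇒FEdge M@(mat a b c d det≡1) x y x≈ y≈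
  with ≈column₁⇒unitMultiple M x x≈ | ≈column₁⇒unitMultiple (swapColumns M) y y≈
... | l , ∣l∣≡1 , P≡la , Q≡lc | m , ∣m∣≡1 , R≡mb , S≡md = begin
  ∣ ⟦ x , y ⟧ ∣                              ≡⟨ cong ∣_∣ (cong₂ _-_ (cong₂ _*_ P≡la S≡md) (cong₂ _*_ Q≡lc R≡mb)) ⟩
  ∣ (l * a) * (m * d) - (l * c) * (m * b) ∣  ≡⟨ cong ∣_∣ (e l m a b c d) ⟩
  ∣ (l * m) * det a b c d ∣                  ≡⟨ cong (λ t → ∣ (l * m) * t ∣) det≡1 ⟩
  ∣ (l * m) * 1ℤ ∣                           ≡⟨ cong ∣_∣ (ℤₚ.*-identityʳ (l * m)) ⟩
  ∣ l * m ∣                                  ≡⟨ ∣i∣≡1∧∣j∣≡1⇒∣i*j∣≡1 l m ∣l∣≡1 ∣m∣≡1 ⟩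
  1                                          ∎
  where
  open ≡-Reasoning
  e : ∀ l m a b c d → (l * a) * (m * d) - (l * c) * (m * b) ≡ (l * m) * (a * d - b * c)
  e = solve-∀

columns⇒FnEdge : ∀ n M x y → let open SL₂ℤ M in + n ∣ c → x ≈ (a , c) → y ≈ (b , d) → FnEdge n x y
columns⇒FnEdge n (mat a b c d det≡1) x y n∣c x≈ y≈ with Signed.∣ᵤ⇒∣ {+ n} {c} n∣c
... | Signed.divides q refl = column₁ M′ , column₂ M′ , columns-FEdge M′ , x≈z , y≈w
  where
  N : ℤ
  N = + n
  e₁ : ∀ a b d q N → a * d - (N * b) * q ≡ a * d - b * (q * N)
  e₁ = solve-∀
  M′ : SL₂ℤ
  M′ = mat a (N * b) q d (trans (e₁ a b d q N) det≡1)
  x≈z : x ≈ scale n (column₁ M′)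
  x≈z = trans (cong (num x *_) (ℤₚ.*-comm N q)) x≈
  e₂ : ∀ R N d → R * (N * d) ≡ N * (R * d)
  e₂ = solve-∀
  y≈w : y ≈ scale n (column₂ M′)
  y≈w = begin
    num y * (N * d)      ≡⟨ e₂ (num y) N d ⟩
    N * (num y * d)      ≡⟨ cong (N *_) y≈ ⟩
    N * (b * den y)      ≡⟨ ℤₚ.*-assoc N b (den y) ⟨
    N * b * den y        ∎
    where open ≡-Reasoning

columns⇒CommonEdge : ∀ n M x y → let open SL₂ℤ M in + n ∣ c → x ≈ (a , c) → y ≈ (b , d) → CommonEdge n x y
columns⇒CommonEdge n M x y n∣c x≈ y≈ = columns⇒FEdge M x y x≈ y≈ , columns⇒FnEdge n M x y n∣c x≈ y≈

Γ₀Edge⇒CommonEdge : ∀ n x y → Γ₀Edge n x y → CommonEdge n x y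
Γ₀Edge⇒CommonEdge n x y (a , b , c , d , det≡1 , n∣c , inj₁ (x≈ , y≈)) =
  columns⇒CommonEdge n (mat a b c d det≡1) x y n∣c x≈ y≈
Γ₀Edge⇒CommonEdge n x y (a , b , c , d , det≡1 , n∣c , inj₂ (x≈ , y≈)) =
  CommonEdge-sym n y x (columns⇒CommonEdge n (mat a b c d det≡1) y x n∣c y≈ x≈)

column₁⇒∣den : ∀ n M x → let open SL₂ℤ M in + n ∣ c → x ≈ (a , c) → + n ∣ den x
column₁⇒∣den n M x n∣c x≈ with ≈column₁⇒unitMultiple M x x≈
... | l , _ , _ , Q≡lc = subst (+ n ∣_) (sym Q≡lc) (∣j⇒∣i*j {+ n} l n∣c)

Γ₀Edge⇒∣den : ∀ n x y → Γ₀Edge n x y → (+ n ∣ den x) ⊎ (+ n ∣ den y)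
Γ₀Edge⇒∣den n x y (a , b , c , d , det≡1 , n∣c , inj₁ (x≈ , _)) = inj₁ (column₁⇒∣den n (mat a b c d det≡1) x n∣c x≈)
Γ₀Edge⇒∣den n x y (a , b , c , d , det≡1 , n∣c , inj₂ (_ , y≈)) = inj₂ (column₁⇒∣den n (mat a b c d det≡1) y n∣c y≈)

FEdge⇒SL₂ℤ : ∀ x y → FEdge x y → SL₂ℤ
FEdge⇒SL₂ℤ x y f = mat (num x) (⟦ x , y ⟧ * num y) (den x) (⟦ x , y ⟧ * den y)
  (trans (e (num x) (den x) (num y) (den y)) (∣i∣≡1⇒i*i≡1 ⟦ x , y ⟧ f))
  where
  e : ∀ P Q R S → P * ((P * S - Q * R) * S) - ((P * S - Q * R) * R) * Q ≡ (P * S - Q * R) * (P * S - Q * R)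
  e = solve-∀

FEdge⇒coprime-num : ∀ x y → FEdge x y → Coprime (num x) (num y)
FEdge⇒coprime-num x y f =
  bézout⇒coprime (num x) (num y) (trans (e (num x) (den x) (num y) (den y)) (∣i∣≡1⇒i*i≡1 ⟦ x , y ⟧ f))
  where
  e : ∀ P Q R S → P * ((P * S - Q * R) * S) + R * (- ((P * S - Q * R) * Q)) ≡ (P * S - Q * R) * (P * S - Q * R)
  e = solve-∀

FEdge∧∣den⇒Γ₀Edge : ∀ n x y → FEdge x y → + n ∣ den x → Γ₀Edge n x y
FEdge∧∣den⇒Γ₀Edge n x y f n∣Q =
  num x , D * num y , den x , D * den y , SL₂ℤ.det≡1 (FEdge⇒SL₂ℤ x y f) , n∣Q , inj₁ (refl , e (num y) D (den y))
  where
  D : ℤ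
  D = ⟦ x , y ⟧
  e : ∀ R D S → R * (D * S) ≡ (D * R) * S
  e = solve-∀

FEdge∧∣den⊎∣den⇒Γ₀Edge : ∀ n x y → FEdge x y → (+ n ∣ den x) ⊎ (+ n ∣ den y) → Γ₀Edge n x y
FEdge∧∣den⊎∣den⇒Γ₀Edge n x y f (inj₁ n∣Q) = FEdge∧∣den⇒Γ₀Edge n x y f n∣Q
FEdge∧∣den⊎∣den⇒Γ₀Edge n x y f (inj₂ n∣S) = Γ₀Edge-sym n y x (FEdge∧∣den⇒Γ₀Edge n y x (FEdge-sym x y f) n∣S)

FEdge∧≈scale⇒multiple : ∀ n x y z → FEdge x y → x ≈ scale n z →
                        Σ ℤ λ l → num z ≡ l * num x × + n * den z ≡ l * den x
FEdge∧≈scale⇒multiple n x y z f x≈z = parallel⇒multiple (FEdge⇒SL₂ℤ x y f) (sym x≈z)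

⟦⟧-multiples : ∀ N l m x y z w → num z ≡ l * num x → N * den z ≡ l * den x →
               num w ≡ m * num y → N * den w ≡ m * den y → N * ⟦ z , w ⟧ ≡ (l * m) * ⟦ x , y ⟧
⟦⟧-multiples N l m x y z w z₁≡lP Nz₂≡lQ w₁≡mR Nw₂≡mS = begin
  N * ⟦ z , w ⟧                                            ≡⟨ e₁ N (num z) (den z) (num w) (den w) ⟩
  num z * (N * den w) - (N * den z) * num w               ≡⟨ cong₂ _-_ (cong₂ _*_ z₁≡lP Nw₂≡mS) (cong₂ _*_ Nz₂≡lQ w₁≡mR) ⟩
  (l * num x) * (m * den y) - (l * den x) * (m * num y)   ≡⟨ e₂ l m (num x) (den x) (num y) (den y) ⟩
  (l * m) * ⟦ x , y ⟧                                      ∎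
  where
  open ≡-Reasoning
  e₁ : ∀ N z₁ z₂ w₁ w₂ → N * (z₁ * w₂ - z₂ * w₁) ≡ z₁ * (N * w₂) - (N * z₂) * w₁
  e₁ = solve-∀
  e₂ : ∀ l m P Q R S → (l * P) * (m * S) - (l * Q) * (m * R) ≡ (l * m) * (P * S - Q * R)
  e₂ = solve-∀

FEdges∧⟦⟧-multiple⇒n≡∣l∣*∣m∣ : ∀ n l m x y z w → FEdge x y → FEdge z w →
                               + n * ⟦ z , w ⟧ ≡ (l * m) * ⟦ x , y ⟧ → n ≡ ∣ l ∣ ℕ.* ∣ m ∣
FEdges∧⟦⟧-multiple⇒n≡∣l∣*∣m∣ n l m x y z w fxy fzw n⟦z,w⟧≡lm⟦x,y⟧ = begin
  n                            ≡⟨ ℕₚ.*-identityʳ n ⟨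
  n ℕ.* 1                      ≡⟨ cong (n ℕ.*_) fzw ⟨
  n ℕ.* ∣ ⟦ z , w ⟧ ∣           ≡⟨ ℤₚ.abs-* (+ n) ⟦ z , w ⟧ ⟨
  ∣ + n * ⟦ z , w ⟧ ∣           ≡⟨ cong ∣_∣ n⟦z,w⟧≡lm⟦x,y⟧ ⟩
  ∣ (l * m) * ⟦ x , y ⟧ ∣       ≡⟨ ℤₚ.abs-* (l * m) ⟦ x , y ⟧ ⟩
  ∣ l * m ∣ ℕ.* ∣ ⟦ x , y ⟧ ∣   ≡⟨ cong (∣ l * m ∣ ℕ.*_) fxy ⟩
  ∣ l * m ∣ ℕ.* 1              ≡⟨ ℕₚ.*-identityʳ ∣ l * m ∣ ⟩
  ∣ l * m ∣                    ≡⟨ ℤₚ.abs-* l m ⟩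
  ∣ l ∣ ℕ.* ∣ m ∣              ∎
  where open ≡-Reasoning

CommonEdge⇒coprimeScalars : ∀ n x y → CommonEdge n x y →
  Σ ℤ λ l → Σ ℤ λ m → Coprime l m × n ≡ ∣ l ∣ ℕ.* ∣ m ∣ × (+ n ∣ l * den x) × (+ n ∣ m * den y)
CommonEdge⇒coprimeScalars n x y (fxy , z , w , fzw , x≈z , y≈w) =
  combine (FEdge∧≈scale⇒multiple n x y z fxy x≈z) (FEdge∧≈scale⇒multiple n y x w (FEdge-sym x y fxy) y≈w)
  where
  combine : (Σ ℤ λ l → num z ≡ l * num x × + n * den z ≡ l * den x) →
            (Σ ℤ λ m → num w ≡ m * num y × + n * den w ≡ m * den y) →
            Σ ℤ λ l → Σ ℤ λ m → Coprime l m × n ≡ ∣ l ∣ ℕ.* ∣ m ∣ × (+ n ∣ l * den x) × (+ n ∣ m * den y)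
  combine (l , z₁≡lP , nz₂≡lQ) (m , w₁≡mR , nw₂≡mS) =
    l , m ,
    coprime∧∣⇒coprime (FEdge⇒coprime-num z w fzw)
      (subst (l ∣_) (sym z₁≡lP) (i∣i*j l (num x))) (subst (m ∣_) (sym w₁≡mR) (i∣i*j m (num y))) ,
    FEdges∧⟦⟧-multiple⇒n≡∣l∣*∣m∣ n l m x y z w fxy fzw (⟦⟧-multiples (+ n) l m x y z w z₁≡lP nz₂≡lQ w₁≡mR nw₂≡mS) ,
    subst (+ n ∣_) nz₂≡lQ (i∣i*j (+ n) (den z)) ,
    subst (+ n ∣_) nw₂≡mS (i∣i*j (+ n) (den w))

p∤m∧m*n≡p^ℓ⇒m≡1 : ∀ {p} → Prime p → ∀ ℓ {m n} → ¬ p ℕ.∣ m → m ℕ.* n ≡ p ℕ.^ ℓ → m ≡ 1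
p∤m∧m*n≡p^ℓ⇒m≡1 p-prime ℕ.zero {m} {n} _ mn≡1 = ℕₚ.m*n≡1⇒m≡1 m n mn≡1
p∤m∧m*n≡p^ℓ⇒m≡1 {p} p-prime (ℕ.suc ℓ) {m} {n} p∤m mn≡p^ℓ⁺
  with euclidsLemma m n p-prime (ℕ.divides (p ℕ.^ ℓ) (trans mn≡p^ℓ⁺ (ℕₚ.*-comm p (p ℕ.^ ℓ))))
... | inj₁ p∣m = contradiction p∣m p∤m
... | inj₂ (ℕ.divides n′ refl) = p∤m∧m*n≡p^ℓ⇒m≡1 p-prime ℓ p∤m
  (ℕₚ.*-cancelʳ-≡ (m ℕ.* n′) (p ℕ.^ ℓ) p {{prime⇒nonZero p-prime}}
    (trans (ℕₚ.*-assoc m n′ p) (trans mn≡p^ℓ⁺ (ℕₚ.*-comm p (p ℕ.^ ℓ)))))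

coprime∧m*n≡p^ℓ⇒m≡1⊎n≡1 : ∀ {p} → Prime p → ∀ ℓ {m n} → ℕ.Coprime m n → m ℕ.* n ≡ p ℕ.^ ℓ → m ≡ 1 ⊎ n ≡ 1
coprime∧m*n≡p^ℓ⇒m≡1⊎n≡1 p-prime ℕ.zero {m} {n} _ mn≡1 = inj₁ (ℕₚ.m*n≡1⇒m≡1 m n mn≡1)
coprime∧m*n≡p^ℓ⇒m≡1⊎n≡1 {p} p-prime ℓ@(ℕ.suc ℓ′) {m} {n} coprime mn≡p^ℓ =
  Sum.swap (Sum.map n≡1 m≡1 (euclidsLemma m n p-prime (ℕ.divides (p ℕ.^ ℓ′) (trans mn≡p^ℓ (ℕₚ.*-comm p (p ℕ.^ ℓ′))))))
  where
  p∤both : p ℕ.∣ m → ¬ p ℕ.∣ n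
  p∤both p∣m p∣n = ℕ.nonTrivial⇒≢1 {{prime⇒nonTrivial p-prime}} (coprime (p∣m , p∣n))
  n≡1 : p ℕ.∣ m → n ≡ 1
  n≡1 p∣m = p∤m∧m*n≡p^ℓ⇒m≡1 p-prime ℓ (p∤both p∣m) (trans (ℕₚ.*-comm n m) mn≡p^ℓ)
  m≡1 : p ℕ.∣ n → m ≡ 1
  m≡1 p∣n = p∤m∧m*n≡p^ℓ⇒m≡1 p-prime ℓ (λ p∣m → p∤both p∣m p∣n) mn≡p^ℓ

primePower∧CommonEdge⇒∣den : ∀ n x y → IsPrimePower n → CommonEdge n x y → (+ n ∣ den x) ⊎ (+ n ∣ den y)
primePower∧CommonEdge⇒∣den n x y (p , ℓ , p-prime , n≡p^ℓ) common = conclude (CommonEdge⇒coprimeScalars n x y common)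
  where
  conclude : (Σ ℤ λ l → Σ ℤ λ m → Coprime l m × n ≡ ∣ l ∣ ℕ.* ∣ m ∣ × (+ n ∣ l * den x) × (+ n ∣ m * den y)) →
             (+ n ∣ den x) ⊎ (+ n ∣ den y)
  conclude (l , m , coprime , n≡∣l∣∣m∣ , n∣lQ , n∣mS) =
    Sum.map (λ ∣l∣≡1 → ∣i∣≡1∧k∣i*j⇒k∣j {+ n} l ∣l∣≡1 n∣lQ) (λ ∣m∣≡1 → ∣i∣≡1∧k∣i*j⇒k∣j {+ n} m ∣m∣≡1 n∣mS)
      (coprime∧m*n≡p^ℓ⇒m≡1⊎n≡1 p-prime ℓ coprime (trans (sym n≡∣l∣∣m∣) n≡p^ℓ))

primePower⇒CommonEdge⊆Γ₀Edge : ∀ n → IsPrimePower n → ∀ x y → CommonEdge n x y → Γ₀Edge n x y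
primePower⇒CommonEdge⊆Γ₀Edge n primePower x y common@(fxy , _) =
  FEdge∧∣den⊎∣den⇒Γ₀Edge n x y fxy (primePower∧CommonEdge⇒∣den n x y primePower common)

pos-bézout : ∀ a b c d → 1 ℕ.+ a ℕ.* b ≡ c ℕ.* d → + c * + d - + a * + b ≡ 1ℤ
pos-bézout a b c d eq = begin
  + c * + d - + a * + b          ≡⟨ cong (_- + a * + b) (ℤₚ.pos-* c d) ⟨
  + (c ℕ.* d) - + a * + b        ≡⟨ cong (λ t → + t - + a * + b) eq ⟨
  + (1 ℕ.+ a ℕ.* b) - + a * + b  ≡⟨ cong (λ t → + 1 + t - + a * + b) (ℤₚ.pos-* a b) ⟩
  + 1 + + a * + b - + a * + b    ≡⟨ e (+ a * + b) ⟩
  1ℤ                             ∎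
  where
  open ≡-Reasoning
  e : ∀ t → + 1 + t - t ≡ 1ℤ
  e = solve-∀

coprime⇒bézout : ∀ {m k} → ℕ.Coprime m k → Σ ℤ λ α → Σ ℤ λ β → + m * α - + k * β ≡ 1ℤ
coprime⇒bézout {m} {k} coprime with ℕ.coprime-Bézout coprime
... | Bézout.+- x y eq = + x , + y , trans (e (+ m) (+ k) (+ x) (+ y)) (pos-bézout y k x m eq)
  where
  e : ∀ M K X Y → M * X - K * Y ≡ X * M - Y * K
  e = solve-∀
... | Bézout.-+ x y eq = - + x , - + y , trans (e (+ m) (+ k) (+ x) (+ y)) (pos-bézout x m y k eq)
  where
  e : ∀ M K X Y → M * (- X) - K * (- Y) ≡ Y * K - X * M
  e = solve-∀

opaque
  coprimeFactors⇒CommonEdge∧¬∣den : ∀ m k → .{{ℕ.NonTrivial m}} → .{{ℕ.NonTrivial k}} → ℕ.Coprime m k →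
    Σ Point λ x → Σ Point λ y → CommonEdge (m ℕ.* k) x y × ¬ ((+ (m ℕ.* k) ∣ den x) ⊎ (+ (m ℕ.* k) ∣ den y))
  coprimeFactors⇒CommonEdge∧¬∣den m k coprime with coprime⇒bézout coprime
  ... | α , β , mα-kβ≡1 =
    column₁ X , column₂ X , (columns-FEdge X , column₁ Z , column₂ Z , columns-FEdge Z , x≈z , y≈w) , ¬∣den
    where
    M K N : ℤ
    M = + m
    K = + k
    N = + (m ℕ.* k)
    e₁ : ∀ α β M K → α * M - 1ℤ * (K * β) ≡ M * α - K * β
    e₁ = solve-∀
    X : SL₂ℤ
    X = mat α 1ℤ (K * β) M (trans (e₁ α β M K) mα-kβ≡1)
    e₂ : ∀ α β M K → (M * α) * 1ℤ - K * β ≡ M * α - K * β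
    e₂ = solve-∀
    Z : SL₂ℤ
    Z = mat (M * α) K β 1ℤ (trans (e₂ α β M K) mα-kβ≡1)
    e₃ : ∀ α β M K → α * ((M * K) * β) ≡ (M * α) * (K * β)
    e₃ = solve-∀
    x≈z : column₁ X ≈ scale (m ℕ.* k) (column₁ Z)
    x≈z = subst (λ t → α * (t * β) ≡ (M * α) * (K * β)) (sym (ℤₚ.pos-* m k)) (e₃ α β M K)
    e₄ : ∀ M K → 1ℤ * ((M * K) * 1ℤ) ≡ K * M
    e₄ = solve-∀
    y≈w : column₂ X ≈ scale (m ℕ.* k) (column₂ Z)
    y≈w = subst (λ t → 1ℤ * (t * 1ℤ) ≡ K * M) (sym (ℤₚ.pos-* m k)) (e₄ M K)
    instance
      m≢0 : ℕ.NonZero m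
      m≢0 = ℕ.nonTrivial⇒nonZero m
      k≢0 : ℕ.NonZero k
      k≢0 = ℕ.nonTrivial⇒nonZero k
    ¬∣den : ¬ ((N ∣ K * β) ⊎ (N ∣ M))
    ¬∣den (inj₁ mk∣kβ) = ℕ.nonTrivial⇒≢1 (ℕ.∣1⇒≡1 (Signed.∣⇒∣ᵤ {M} (subst (M Signed.∣_) mα-kβ≡1 m∣mα-kβ)))
      where
      m∣β : m ℕ.∣ ∣ β ∣
      m∣β = ℕ.*-cancelˡ-∣ k (subst₂ ℕ._∣_ (ℕₚ.*-comm m k) (ℤₚ.abs-* K β) mk∣kβ)
      m∣mα-kβ : M Signed.∣ M * α - K * β
      m∣mα-kβ = Signed.∣m∣n⇒∣m-n (Signed.∣m⇒∣m*n α Signed.∣-refl) (Signed.∣n⇒∣m*n K (Signed.∣ᵤ⇒∣ {M} {β} m∣β))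
    ¬∣den (inj₂ mk∣m) =
      ℕ.nonTrivial⇒≢1 {k} (ℕ.∣1⇒≡1 (ℕ.*-cancelˡ-∣ m (subst (m ℕ.* k ℕ.∣_) (sym (ℕₚ.*-identityʳ m)) mk∣m)))

record NontrivialCoprimeFactorisation (n : ℕ) : Set where
  constructor factorisation
  field
    m k : ℕ
    1<m : 1 ℕ.< m
    1<k : 1 ℕ.< k
    coprime : ℕ.Coprime m k
    n≡m*k : n ≡ m ℕ.* k

nontrivialCoprimeFactorisation⇒CommonEdge⊈Γ₀Edge : ∀ {n} → NontrivialCoprimeFactorisation n →
                                                   ¬ (∀ x y → CommonEdge n x y → Γ₀Edge n x y)
nontrivialCoprimeFactorisation⇒CommonEdge⊈Γ₀Edge (factorisation m k 1<m 1<k coprime refl) common⇒Γ₀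
  with coprimeFactors⇒CommonEdge∧¬∣den m k {{ℕ.n>1⇒nonTrivial 1<m}} {{ℕ.n>1⇒nonTrivial 1<k}} coprime
... | x , y , common , ¬∣den = ¬∣den (Γ₀Edge⇒∣den (m ℕ.* k) x y (common⇒Γ₀ x y common))

primeDivisor : ∀ n → .{{ℕ.NonTrivial n}} → Σ ℕ λ p → Prime p × p ℕ.∣ n
primeDivisor n with factorise n {{ℕ.nonTrivial⇒nonZero n}}
... | record { factors = [] ; isFactorisation = n≡1 } = contradiction n≡1 ℕ.nonTrivial⇒≢1
... | record { factors = p ∷ ps ; isFactorisation = n≡p*Πps ; factorsPrime = p-prime ∷ _ } =
  p , p-prime , ℕ.divides (product ps) (trans n≡p*Πps (ℕₚ.*-comm p (product ps)))

p-adicDecomposition : ∀ {p} → Prime p → ∀ n → .{{ℕ.NonZero n}} →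
                      Σ ℕ λ e → Σ ℕ λ r → n ≡ p ℕ.^ e ℕ.* r × ¬ p ℕ.∣ r
p-adicDecomposition {p} p-prime n = go n (<-wellFounded n)
  where
  Decomposition : ℕ → Set
  Decomposition n = Σ ℕ λ e → Σ ℕ λ r → n ≡ p ℕ.^ e ℕ.* r × ¬ p ℕ.∣ r
  reassoc : ∀ a r p → a ℕ.* r ℕ.* p ≡ p ℕ.* a ℕ.* r
  reassoc = ℕ-RingSolver.solve-∀
  step : ∀ {q} → Decomposition q → Decomposition (q ℕ.* p)
  step (e , r , q≡p^e*r , p∤r) = ℕ.suc e , r , trans (cong (ℕ._* p) q≡p^e*r) (reassoc (p ℕ.^ e) r p) , p∤r
  1<p : 1 ℕ.< p
  1<p = ℕ.nonTrivial⇒n>1 p {{prime⇒nonTrivial p-prime}}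
  go : ∀ n → .{{ℕ.NonZero n}} → Acc ℕ._<_ n → Decomposition n
  go n (acc rec) with p ℕ.∣? n
  ... | no p∤n = 0 , n , sym (ℕₚ.+-identityʳ n) , p∤n
  ... | yes (ℕ.divides q refl) = step (go q {{ℕₚ.m*n≢0⇒m≢0 q}} (rec (ℕₚ.m<m*n q p {{ℕₚ.m*n≢0⇒m≢0 q}} 1<p)))

p∤n⇒coprime[p^e,n] : ∀ {p n} → Prime p → ¬ p ℕ.∣ n → ∀ e → ℕ.Coprime (p ℕ.^ e) n
p∤n⇒coprime[p^e,n] p-prime p∤n e {i} (ℕ.divides j p^e≡ji , i∣n) =
  p∤m∧m*n≡p^ℓ⇒m≡1 p-prime e (λ p∣i → p∤n (ℕ.∣-trans p∣i i∣n)) (trans (ℕₚ.*-comm i j) (sym p^e≡ji))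

prime⇒1<p^[1+e] : ∀ {p} → Prime p → ∀ e → 1 ℕ.< p ℕ.^ ℕ.suc e
prime⇒1<p^[1+e] {p} p-prime e = ℕₚ.<-≤-trans (ℕ.nonTrivial⇒n>1 p {{prime⇒nonTrivial p-prime}})
  (ℕₚ.m≤m*n p (p ℕ.^ e) {{ℕₚ.m^n≢0 p e {{prime⇒nonZero p-prime}}}})

primePower⊎nontrivialCoprimeFactorisation : ∀ n → .{{ℕ.NonZero n}} →
                                            IsPrimePower n ⊎ NontrivialCoprimeFactorisation n
primePower⊎nontrivialCoprimeFactorisation 1 = inj₁ (2 , 0 , prime[2] , refl)
primePower⊎nontrivialCoprimeFactorisation n@(2+ _) with primeDivisor n
... | p , p-prime , p∣n with p-adicDecomposition p-prime n
... | e , 0 , n≡p^e*0 , _ = contradiction (trans n≡p^e*0 (ℕₚ.*-zeroʳ (p ℕ.^ e))) λ ()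
... | e , 1 , n≡p^e*1 , _ = inj₁ (p , e , p-prime , trans n≡p^e*1 (ℕₚ.*-identityʳ _))
... | 0 , r@(2+ _) , n≡r+0 , p∤r = contradiction (subst (p ℕ.∣_) (trans n≡r+0 (ℕₚ.+-identityʳ r)) p∣n) p∤r
... | e@(ℕ.suc e′) , r@(2+ _) , n≡p^e*r , p∤r = inj₂ (factorisation (p ℕ.^ e) r (prime⇒1<p^[1+e] p-prime e′)
  (ℕ.s≤s (ℕ.s≤s ℕ.z≤n)) (p∤n⇒coprime[p^e,n] p-prime p∤r e) n≡p^e*r)

CommonEdge⊆Γ₀Edge⇒primePower : ∀ n → .{{ℕ.NonZero n}} → (∀ x y → CommonEdge n x y → Γ₀Edge n x y) → IsPrimePower n
CommonEdge⊆Γ₀Edge⇒primePower n common⇒Γ₀ with primePower⊎nontrivialCoprimeFactorisation n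
... | inj₁ primePower = primePower
... | inj₂ factors = contradiction common⇒Γ₀ (nontrivialCoprimeFactorisation⇒CommonEdge⊈Γ₀Edge factors)

mainTheorem11 : (n : ℕ) → 1 ≤ n →
    ((x y : Point) → Γ₀Edge n x y → CommonEdge n x y)
    × ((((x y : Point) → Γ₀Edge n x y → CommonEdge n x y)
        × ((x y : Point) → CommonEdge n x y → Γ₀Edge n x y))
       ⇔ IsPrimePower n)
mainTheorem11 n 1≤n = Γ₀Edge⇒CommonEdge n , mk⇔
  (λ (_ , common⇒Γ₀) → CommonEdge⊆Γ₀Edge⇒primePower n {{ℕ.>-nonZero 1≤n}} common⇒Γ₀)
  (λ primePower → Γ₀Edge⇒CommonEdge n , primePower⇒CommonEdge⊆Γ₀Edge n primePower)
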